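{- Let $\mathcal{M}\subseteq\binom{[n]}{k}$ be a positroid with Grassmann necklace $(I_1,\dots,I_n)$ and decorated permutation $\pi^{:}=(\pi,col)$, and let $j\in[n]$ with $\pi(j)\neq j$. Let $\mathcal{M}'=\{H\in\mathcal{M}: j\in H\}$ (a positroid) and let $(K_1,\dots,K_n)$ be its Grassmann necklace. Then for every $a\in[n]$: if $j\in I_a$ then $K_a=I_a$, and if $j\notin I_a$ then $$K_a=\bigl(I_a\setminus\{\max_a(I_a\setminus I_j)\}\bigr)\cup\{j\}.$$
   Context: Ground set $[n]$, identified with $\mathbb{Z}_n$ (indices mod $n$). For $t\in[n]$, $\le_t$ is the total order $t<_t t+1<_t\cdots<_t n<_t 1<_t\cdots<_t t-1$; $\max_t(D)$ is the maximum of $D\subseteq[n]$ with respect to $\le_t$. For $k$-subsets $A=\{i_1<_t\cdots<_t i_k\}$, $B=\{j_1<_t\cdots<_t j_k\}$, $A\le_t B$ iff $i_r\le_t j_r$ for all $r$. A Grassmann necklace is a sequence $(I_1,\dots,I_n)$ of $k$-subsets of $[n]$ such that for each $i$: if $i\in I_i$ then $I_{i+1}=(I_i\setminus\{i\})\cup\{j\}$ for some $j$, and if $i\notin I_i$ then $I_{i+1}=I_i$. A positroid is a collection $\mathcal{M}\subseteq\binom{[n]}{k}$ for which there is a Grassmann necklace with $H\in\mathcal{M}$ iff $H\ge_t I_t$ for all $t\in[n]$; this is its Grassmann necklace. A decorated permutation is $\pi\in S_n$ with a coloring $col$ of its fixed points by $\{1,-1\}$; the decorated permutation of a necklace has $\pi(i)=j$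 when $I_{i+1}=(I_i\setminus\{i\})\cup\{j\}$, $j\ne i$, and $\pi(i)=i$ otherwise (with $col(i)=1$ if $i\notin I_i$, $col(i)=-1$ if $i\in I_i$). -}

module Defs where

open import Data.Nat using (ℕ; zero; suc; _+_; _∸_; _≤_; _%_)
open import Data.Nat.DivMod using (_mod_)
open import Data.Fin using (Fin; toℕ)
open import Data.Fin.Subset using (Subset; _∈_; _∉_; _∪_; _─_; _-_; ⁅_⁆; ∣_∣)
open import Data.Fin.Subset.Properties using (_∈?_)
open import Data.List using (List; map; filter; last; upTo)
open import Data.List.Relation.Binary.Pointwise using (Pointwise)
open import Data.Maybe using (Maybe)
open import Data.Product using (_×_; Σ; ∃)
open import Relation.Binary.PropositionalEquality using (_≡_; _≢_)
open import Relation.Nullary using (¬_)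

-- Ground set [n] is Fin n, identified with Z_n (element i of Fin n stands for i+1).

rot : {n : ℕ} → Fin n → ℕ → Fin n
rot {suc m} t r = (toℕ t + r) mod (suc m)

next : {n : ℕ} → Fin n → Fin n
next i = rot i 1

-- position of i in the order ≤_t : t, t+1, ..., t-1  (i.e. (i - t) mod n)
rank : {n : ℕ} → Fin n → Fin n → ℕ
rank {suc m} t i = (toℕ i + (suc m ∸ toℕ t)) % suc m

_≤[_]_ : {n : ℕ} → Fin n → Fin n → Fin n → Set
i ≤[ t ] j = rank t i ≤ rank t j

sortedₜ : {n : ℕ} → Fin n → Subset n → List (Fin n)
sortedₜ {n} t A = filter (λ x → x ∈? A) (map (rot t) (upTo n))

maxₜ : {n : ℕ} → Fin n → Subset n → Maybe (Fin n)
maxₜ t D = last (sortedₜ t D)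

_⊑[_]_ : {n : ℕ} → Subset n → Fin n → Subset n → Set
A ⊑[ t ] B = Pointwise (λ i j → i ≤[ t ] j) (sortedₜ t A) (sortedₜ t B)

IsGrassmannNecklace : (n k : ℕ) → (Fin n → Subset n) → Set
IsGrassmannNecklace n k I =
  ((i : Fin n) → ∣ I i ∣ ≡ k) ×
  ((i : Fin n) →
     (i ∈ I i → ∃ λ j → I (next i) ≡ (I i - i) ∪ ⁅ j ⁆) ×
     (i ∉ I i → I (next i) ≡ I i))

IsPositroidWithNecklace : (n k : ℕ) → (Subset n → Set) → (Fin n → Subset n) → Set
IsPositroidWithNecklace n k M I =
  IsGrassmannNecklace n k I ×
  ((H : Subset n) →
     (M H → (∣ H ∣ ≡ k × ((t : Fin n) → I t ⊑[ t ] H))) ×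
     ((∣ H ∣ ≡ k × ((t : Fin n) → I t ⊑[ t ] H)) → M H))

-- σ is the permutation part of the decorated permutation of the necklace I:
-- σ(i) = j ≠ i when I_{i+1} = (I_i \ {i}) ∪ {j} with i ∈ I_i, and σ(i) = i otherwise.
IsNecklacePerm : {n : ℕ} → (Fin n → Subset n) → (Fin n → Fin n) → Set
IsNecklacePerm {n} I σ =
  (i : Fin n) →
    (σ i ≢ i → (i ∈ I i × I (next i) ≡ (I i - i) ∪ ⁅ σ i ⁆)) ×
    (σ i ≡ i → (j : Fin n) → j ≢ i → ¬ (i ∈ I i × I (next i) ≡ (I i - i) ∪ ⁅ j ⁆))

-- For a base point t, write A ≼[ t ] B when every initial segment of the cyclic order ≤_t contains at
-- least as many elements of A as of B; for sets of equal size this is the Gale order A ≤_t B, and ≼[ t ]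
-- is antisymmetric. So a k-set H lies in M iff I t ≼[ t ] H for all t, and K a is the ≼[ a ]-least
-- member of M′ = {H ∈ M : j ∈ H}; it suffices to exhibit some member of M′ below all others.
-- Elements of the necklace persist: x ∈ I s stays in I (s + 1), I (s + 2), … until step x, whence
-- I t ≼[ t ] I s for all s, so each I s lies in M. If j ∈ I a this makes I a the least member of M′.
-- Otherwise j ∈ I j (as π j ≢ j) and I a ⊈ I j, so m = max_a (I a ∖ I j) exists; put X = I a - m + j.
-- X ∈ M: for each t and each initial segment of ≤_t, X is compared with I a or with I j according to
-- where j, m and a fall. X is below every H ∈ M′: only segments of ≤_a containing m but not j need
-- care; there H must make up one element outside the segment, and it does, in the positions before j
-- (compared in ≤_j, where they form a final segment) or at j itself, which H contains and I a does not.

module Submission where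

open import Defs
open import Data.Bool using (Bool; true; false; _∧_; _∨_; not)
open import Data.Bool.Properties using (∧-identityʳ; ∧-zeroʳ; ∧-assoc; ∨-identityʳ; ∨-zeroʳ)
open import Data.Empty using (⊥-elim)
open import Data.Fin using (Fin; zero; suc; toℕ; _≟_)
open import Data.Fin.Properties using (toℕ-fromℕ<; toℕ-injective; toℕ<n) renaming (suc-injective to Fin-suc-injective)
open import Data.Fin.Subset using (Subset; _∈_; _∉_; _⊆_; _∪_; _─_; _-_; ⁅_⁆; ∣_∣)
open import Data.Fin.Subset.Properties
  using (_∈?_; x∈⁅x⁆; x≢y⇒x∉⁅y⁆; nonempty?; x∈p∧x∉q⇒x∈p─q; p⊂q⇒∣p∣<∣q∣)
open import Data.List using (List; []; _∷_; [_]; _++_; length; filter; map; upTo; last)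
open import Data.List.Properties using (filter-reject; filter-all; upTo-∷ʳ; last-map)
open import Data.List.Membership.Propositional using () renaming (_∈_ to _∈ₗ_)
open import Data.List.Membership.Propositional.Properties using (∈-filter⁺; ∈-filter⁻; ∈-upTo⁺; ∈-upTo⁻)
open import Data.List.Relation.Binary.Pointwise as Pointwise using (Pointwise; []; _∷_; Pointwise-length)
open import Data.List.Relation.Unary.All as All using (All; []; _∷_)
open import Data.List.Relation.Unary.All.Properties as All using (all-upTo)
open import Data.List.Relation.Unary.AllPairs using (AllPairs; []; _∷_)
import Data.List.Relation.Unary.AllPairs.Properties as AllPairs
open import Data.List.Relation.Unary.Any using (here; there)
open import Data.Maybe as Maybe using (just)
open import Data.Nat using (ℕ; zero; suc; _+_; _∸_; _≤_; _<_; _%_; z≤n; s≤s; s≤s⁻¹; NonZero)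
open import Data.Nat.DivMod using (%-distribˡ-+; m%n%n≡m%n; [m+n]%n≡m%n; m%n<n; m<n⇒m%n≡m)
open import Data.Nat.Properties hiding (_≟_)
open import Algebra.Properties.CommutativeSemigroup +-commutativeSemigroup
  using (x∙yz≈y∙xz; xy∙z≈y∙xz; xy∙z≈x∙zy; interchange)
open import Data.Product using (Σ; _,_; _×_; proj₁; proj₂)
open import Data.Vec using ([]; _∷_; lookup)
open import Data.Vec.Properties using ([]=⇒lookup; lookup⇒[]=; lookup-zipWith; tabulate∘lookup; tabulate-cong)
open import Function using (_∘_)
open import Function.Bundles using (mk⇔)
open import Relation.Binary.PropositionalEquality hiding ([_]; J)
open import Relation.Nullary using (¬_; Dec; yes; no; does)
open import Relation.Nullary.Decidable using (dec-true; dec-false; does-⇔)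
open import Relation.Unary using (Decidable)

does-true⇒ : ∀ {P : Set} (d : Dec P) → does d ≡ true → P
does-true⇒ (yes p) _ = p

does-false⇒ : ∀ {P : Set} (d : Dec P) → does d ≡ false → ¬ P
does-false⇒ (no ¬p) _ = ¬p

true-false-conflict : ∀ {a} {A : Set} → a ≡ true → a ≡ false → A
true-false-conflict refl ()

∧-trueʳ : ∀ a {b} → b ≡ true → a ∧ b ≡ a
∧-trueʳ a refl = ∧-identityʳ a

∧-falseʳ : ∀ a {b} → b ≡ false → a ∧ b ≡ false
∧-falseʳ a refl = ∧-zeroʳ a

<?-suc-≢ : ∀ a r → a ≢ r → does (a <? suc r) ≡ does (a <? r)
<?-suc-≢ a r a≢r = does-⇔ (mk⇔ (λ a<1+r → ≤∧≢⇒< (s≤s⁻¹ a<1+r) a≢r) m<n⇒m<1+n) (a <? suc r) (a <? r)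

∧-true⁻ˡ : ∀ {a b} → a ∧ b ≡ true → a ≡ true
∧-true⁻ˡ {true} _ = refl

∧-true⁻ʳ : ∀ {a b} → a ∧ b ≡ true → b ≡ true
∧-true⁻ʳ {true} b≡true = b≡true

∧-true⁺ : ∀ {a b} → a ≡ true → b ≡ true → a ∧ b ≡ true
∧-true⁺ refl refl = refl

not-true⁻ : ∀ {a} → not a ≡ true → a ≡ false
not-true⁻ {false} _ = refl

-- Cyclic orders

[m+n%d]%d≡[m+n]%d : ∀ m n d .{{_ : NonZero d}} → (m + n % d) % d ≡ (m + n) % d
[m+n%d]%d≡[m+n]%d m n d = begin
  (m + n % d) % d         ≡⟨ %-distribˡ-+ m (n % d) d ⟩
  (m % d + n % d % d) % d ≡⟨ cong (λ z → (m % d + z) % d) (m%n%n≡m%n n d) ⟩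
  (m % d + n % d) % d     ≡⟨ %-distribˡ-+ m n d ⟨
  (m + n) % d             ∎
  where open ≡-Reasoning

[m%d+n]%d≡[m+n]%d : ∀ m n d .{{_ : NonZero d}} → (m % d + n) % d ≡ (m + n) % d
[m%d+n]%d≡[m+n]%d m n d = begin
  (m % d + n) % d ≡⟨ cong (_% d) (+-comm (m % d) n) ⟩
  (n + m % d) % d ≡⟨ [m+n%d]%d≡[m+n]%d n m d ⟩
  (n + m) % d     ≡⟨ cong (_% d) (+-comm n m) ⟩
  (m + n) % d     ∎
  where open ≡-Reasoning

module Cyclic {n : ℕ} where

  N : ℕ
  N = suc n

  toℕ-rot : (t : Fin N) (r : ℕ) → toℕ (rot t r) ≡ (toℕ t + r) % N
  toℕ-rot t r = toℕ-fromℕ< _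

  rot-cong : (t : Fin N) {r r′ : ℕ} → (toℕ t + r) % N ≡ (toℕ t + r′) % N → rot t r ≡ rot t r′
  rot-cong t {r} {r′} eq = toℕ-injective (trans (toℕ-rot t r) (trans eq (sym (toℕ-rot t r′))))

  rot-zero : (t : Fin N) → rot t 0 ≡ t
  rot-zero t = toℕ-injective (begin
    toℕ (rot t 0)     ≡⟨ toℕ-rot t 0 ⟩
    (toℕ t + 0) % N   ≡⟨ cong (_% N) (+-identityʳ (toℕ t)) ⟩
    toℕ t % N         ≡⟨ m<n⇒m%n≡m (toℕ<n t) ⟩
    toℕ t             ∎)
    where open ≡-Reasoning

  rot-+ : (t : Fin N) (a d : ℕ) → rot (rot t a) d ≡ rot t (a + d)
  rot-+ t a d = toℕ-injective (begin
    toℕ (rot (rot t a) d)        ≡⟨ toℕ-rot (rot t a) d ⟩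
    (toℕ (rot t a) + d) % N      ≡⟨ cong (λ z → (z + d) % N) (toℕ-rot t a) ⟩
    ((toℕ t + a) % N + d) % N    ≡⟨ [m%d+n]%d≡[m+n]%d (toℕ t + a) d N ⟩
    (toℕ t + a + d) % N          ≡⟨ cong (_% N) (+-assoc (toℕ t) a d) ⟩
    (toℕ t + (a + d)) % N        ≡⟨ toℕ-rot t (a + d) ⟨
    toℕ (rot t (a + d))          ∎)
    where open ≡-Reasoning

  rot-+N : (t : Fin N) (a : ℕ) → rot t (a + N) ≡ rot t a
  rot-+N t a = rot-cong t (trans (cong (_% N) (sym (+-assoc (toℕ t) a N))) ([m+n]%n≡m%n (toℕ t + a) N))

  next-rot : (t : Fin N) (r : ℕ) → next (rot t r) ≡ rot t (suc r)
  next-rot t r = trans (rot-+ t r 1) (cong (rot t) (+-comm r 1))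

  rank<N : (t x : Fin N) → rank t x < N
  rank<N t x = m%n<n (toℕ x + (N ∸ toℕ t)) N

  private
    t+[N∸t]≡N : (t : Fin N) → toℕ t + (N ∸ toℕ t) ≡ N
    t+[N∸t]≡N t = m+[n∸m]≡n (<⇒≤ (toℕ<n t))

  rot-rank : (t x : Fin N) → rot t (rank t x) ≡ x
  rot-rank t x = toℕ-injective (begin
    toℕ (rot t (rank t x))                    ≡⟨ toℕ-rot t (rank t x) ⟩
    (toℕ t + (toℕ x + (N ∸ toℕ t)) % N) % N   ≡⟨ [m+n%d]%d≡[m+n]%d (toℕ t) _ N ⟩
    (toℕ t + (toℕ x + (N ∸ toℕ t))) % N       ≡⟨ cong (_% N) (x∙yz≈y∙xz (toℕ t) (toℕ x) _) ⟩
    (toℕ x + (toℕ t + (N ∸ toℕ t))) % N       ≡⟨ cong (λ z → (toℕ x + z) % N) (t+[N∸t]≡N t) ⟩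
    (toℕ x + N) % N                           ≡⟨ [m+n]%n≡m%n (toℕ x) N ⟩
    toℕ x % N                                 ≡⟨ m<n⇒m%n≡m (toℕ<n x) ⟩
    toℕ x                                     ∎)
    where open ≡-Reasoning

  rank-rot : (t : Fin N) {r : ℕ} → r < N → rank t (rot t r) ≡ r
  rank-rot t {r} r<N = begin
    (toℕ (rot t r) + (N ∸ toℕ t)) % N        ≡⟨ cong (λ z → (z + (N ∸ toℕ t)) % N) (toℕ-rot t r) ⟩
    ((toℕ t + r) % N + (N ∸ toℕ t)) % N      ≡⟨ [m%d+n]%d≡[m+n]%d (toℕ t + r) _ N ⟩
    (toℕ t + r + (N ∸ toℕ t)) % N            ≡⟨ cong (_% N) (xy∙z≈y∙xz (toℕ t) r _) ⟩
    (r + (toℕ t + (N ∸ toℕ t))) % N          ≡⟨ cong (λ z → (r + z) % N) (t+[N∸t]≡N t) ⟩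
    (r + N) % N                              ≡⟨ [m+n]%n≡m%n r N ⟩
    r % N                                    ≡⟨ m<n⇒m%n≡m r<N ⟩
    r                                        ∎
    where open ≡-Reasoning

  rank-unique : (s : Fin N) {x : Fin N} {d : ℕ} → d < N → rot s d ≡ x → rank s x ≡ d
  rank-unique s d<N refl = rank-rot s d<N

  rank-self : (t : Fin N) → rank t t ≡ 0
  rank-self t = rank-unique t (s≤s z≤n) (rot-zero t)

  rank-injective : (t : Fin N) {x y : Fin N} → rank t x ≡ rank t y → x ≡ y
  rank-injective t {x} {y} eq = trans (sym (rot-rank t x)) (trans (cong (rot t) eq) (rot-rank t y))

  rank-rebase : (t s x : Fin N) → rank t s ≤ rank t x → rank s x + rank t s ≡ rank t x
  rank-rebase t s x s≤x = begin
    rank s x + rank t s                  ≡⟨ cong (_+ rank t s) (trans (cong (rank s) (sym s+d≡x)) (rank-rot s d<N)) ⟩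
    rank t x ∸ rank t s + rank t s       ≡⟨ m∸n+n≡m s≤x ⟩
    rank t x                             ∎
    where
    open ≡-Reasoning
    d = rank t x ∸ rank t s
    d<N : d < N
    d<N = ≤-<-trans (m∸n≤m (rank t x) (rank t s)) (rank<N t x)
    s+d≡x : rot s d ≡ x
    s+d≡x = begin
      rot s d                     ≡⟨ cong (λ z → rot z d) (rot-rank t s) ⟨
      rot (rot t (rank t s)) d    ≡⟨ rot-+ t (rank t s) d ⟩
      rot t (rank t s + d)        ≡⟨ cong (rot t) (m+[n∸m]≡n s≤x) ⟩
      rot t (rank t x)            ≡⟨ rot-rank t x ⟩
      x                           ∎

  rank-rebase-wrap : (t s x : Fin N) → rank t x < rank t s → rank s x + rank t s ≡ rank t x + N
  rank-rebase-wrap t s x x<s = begin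
    rank s x + rank t s                  ≡⟨ cong (_+ rank t s) (trans (cong (rank s) (sym s+d≡x)) (rank-rot s d<N)) ⟩
    rank t x + N ∸ rank t s + rank t s   ≡⟨ m∸n+n≡m s≤x+N ⟩
    rank t x + N                         ∎
    where
    open ≡-Reasoning
    s≤x+N : rank t s ≤ rank t x + N
    s≤x+N = ≤-trans (<⇒≤ (rank<N t s)) (m≤n+m N (rank t x))
    d = rank t x + N ∸ rank t s
    d<N : d < N
    d<N = +-cancelʳ-< (rank t s) d N
      (subst (_< N + rank t s) (sym (m∸n+n≡m s≤x+N))
        (subst (rank t x + N <_) (+-comm (rank t s) N) (+-monoˡ-< N x<s)))
    s+d≡x : rot s d ≡ x
    s+d≡x = begin
      rot s d                     ≡⟨ cong (λ z → rot z d) (rot-rank t s) ⟨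
      rot (rot t (rank t s)) d    ≡⟨ rot-+ t (rank t s) d ⟩
      rot t (rank t s + d)        ≡⟨ cong (rot t) (m+[n∸m]≡n s≤x+N) ⟩
      rot t (rank t x + N)        ≡⟨ rot-+N t (rank t x) ⟩
      rot t (rank t x)            ≡⟨ rot-rank t x ⟩
      x                           ∎

𝟙 : Bool → ℕ
𝟙 true  = 1
𝟙 false = 0

𝟙-injective : ∀ a b → 𝟙 a ≡ 𝟙 b → a ≡ b
𝟙-injective false false _ = refl
𝟙-injective true  true  _ = refl

𝟙≤1 : ∀ b → 𝟙 b ≤ 1
𝟙≤1 true  = ≤-refl
𝟙≤1 false = z≤n

count : ∀ {m} → (Fin m → Bool) → ℕ
count {zero}  f = 0
count {suc m} f = 𝟙 (f zero) + count (f ∘ suc)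

remove : ∀ {m} → Fin m → (Fin m → Bool) → Fin m → Bool
remove y f x = not (does (x ≟ y)) ∧ f x

count-cong : ∀ {m} (f g : Fin m → Bool) → (∀ x → f x ≡ g x) → count f ≡ count g
count-cong {zero}  f g eq = refl
count-cong {suc m} f g eq = cong₂ _+_ (cong 𝟙 (eq zero)) (count-cong (f ∘ suc) (g ∘ suc) (eq ∘ suc))

count-mono : ∀ {m} (f g : Fin m → Bool) → (∀ x → f x ≡ true → g x ≡ true) → count f ≤ count g
count-mono {zero}  f g f⇒g = z≤n
count-mono {suc m} f g f⇒g = +-mono-≤ (𝟙-mono (f zero) (g zero) (f⇒g zero)) (count-mono (f ∘ suc) (g ∘ suc) (f⇒g ∘ suc))
  where
  𝟙-mono : ∀ a b → (a ≡ true → b ≡ true) → 𝟙 a ≤ 𝟙 b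
  𝟙-mono false b  _   = z≤n
  𝟙-mono true  b  a⇒b with refl ← a⇒b refl = ≤-refl

count-false : ∀ {m} (f : Fin m → Bool) → (∀ x → f x ≡ false) → count f ≡ 0
count-false {zero}  f none = refl
count-false {suc m} f none rewrite none zero = count-false (f ∘ suc) (none ∘ suc)

count-split : ∀ {m} (f p : Fin m → Bool) →
  count f ≡ count (λ x → f x ∧ p x) + count (λ x → f x ∧ not (p x))
count-split {zero}  f p = refl
count-split {suc m} f p = trans (cong₂ _+_ (𝟙-split (f zero) (p zero)) (count-split (f ∘ suc) (p ∘ suc)))
  (interchange (𝟙 (f zero ∧ p zero)) (𝟙 (f zero ∧ not (p zero))) _ _)
  where
  𝟙-split : ∀ a b → 𝟙 a ≡ 𝟙 (a ∧ b) + 𝟙 (a ∧ not b)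
  𝟙-split false b     = refl
  𝟙-split true  false = refl
  𝟙-split true  true  = refl

count-insert : ∀ {m} (f g : Fin m → Bool) (y : Fin m) → (∀ x → x ≢ y → f x ≡ g x) → f y ≡ false →
  count g ≡ 𝟙 (g y) + count f
count-insert {suc m} f g zero    f≡g fy rewrite fy =
  cong (𝟙 (g zero) +_) (sym (count-cong (f ∘ suc) (g ∘ suc) (λ x → f≡g (suc x) (λ ()))))
count-insert {suc m} f g (suc y) f≡g fy = begin
  𝟙 (g zero) + count (g ∘ suc)                     ≡⟨ cong₂ _+_ (cong 𝟙 (sym (f≡g zero (λ ())))) ih ⟩
  𝟙 (f zero) + (𝟙 (g (suc y)) + count (f ∘ suc))  ≡⟨ x∙yz≈y∙xz (𝟙 (f zero)) (𝟙 (g (suc y))) (count (f ∘ suc)) ⟩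
  𝟙 (g (suc y)) + (𝟙 (f zero) + count (f ∘ suc))  ∎
  where
  open ≡-Reasoning
  ih = count-insert (f ∘ suc) (g ∘ suc) y (λ x x≢y → f≡g (suc x) (x≢y ∘ Fin-suc-injective)) fy

count-at : ∀ {m} (f : Fin m → Bool) y → count f ≡ 𝟙 (f y) + count (remove y f)
count-at f y = count-insert (remove y f) f y (λ x x≢y → cong (λ b → not b ∧ f x) (dec-false (x ≟ y) x≢y))
                                             (cong (λ b → not b ∧ f y) (dec-true (y ≟ y) refl))

count-remove : ∀ {m} (f : Fin m → Bool) y → f y ≡ true → count f ≡ suc (count (remove y f))
count-remove f y fy = trans (count-at f y) (cong (λ b → 𝟙 b + count (remove y f)) fy)

remove-true : ∀ {m} (f : Fin m → Bool) y x → remove y f x ≡ true → x ≢ y × f x ≡ true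
remove-true f y x h with x ≟ y
... | no x≢y = x≢y , h

count≤suc : ∀ {m} (f g : Fin m → Bool) y → (∀ x → x ≢ y → f x ≡ true → g x ≡ true) → count f ≤ suc (count g)
count≤suc f g y f⇒g = begin
  count f                       ≡⟨ count-at f y ⟩
  𝟙 (f y) + count (remove y f)  ≤⟨ +-mono-≤ (𝟙≤1 (f y)) (count-mono (remove y f) g removed⇒g) ⟩
  suc (count g)                 ∎
  where
  open ≤-Reasoning
  removed⇒g : ∀ x → remove y f x ≡ true → g x ≡ true
  removed⇒g x h = let x≢y , fx = remove-true f y x h in f⇒g x x≢y fx

count-swap : ∀ {m} (f g : Fin m → Bool) (y z : Fin m) → f y ≡ true → f z ≡ false → g y ≡ false → g z ≡ true →
  (∀ x → x ≢ y → x ≢ z → f x ≡ g x) → count f ≡ count g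
count-swap f g y z fy fz gy gz f≡g = trans (count-remove f y fy)
  (sym (trans (count-insert (remove y f) g z removed≡g removed-z) (cong (λ b → 𝟙 b + count (remove y f)) gz)))
  where
  removed-z : remove y f z ≡ false
  removed-z with z ≟ y
  ... | yes _ = refl
  ... | no _  = fz
  removed≡g : ∀ x → x ≢ z → remove y f x ≡ g x
  removed≡g x x≢z with x ≟ y
  ... | yes refl = sym gy
  ... | no x≢y   = f≡g x x≢y x≢z

surplus⇒deficit : ∀ {m} (f g p : Fin m → Bool) c → count f ≡ count g →
  count (λ x → f x ∧ not (p x)) + c ≤ count (λ x → g x ∧ not (p x)) →
  count (λ x → g x ∧ p x) + c ≤ count (λ x → f x ∧ p x)
surplus⇒deficit f g p c f≡g surplus = +-cancelʳ-≤ f¬p (g∧p + c) f∧p (begin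
  g∧p + c + f¬p     ≡⟨ xy∙z≈x∙zy g∧p c f¬p ⟩
  g∧p + (f¬p + c)   ≤⟨ +-monoʳ-≤ g∧p surplus ⟩
  g∧p + g¬p         ≡⟨ count-split g p ⟨
  count g           ≡⟨ f≡g ⟨
  count f           ≡⟨ count-split f p ⟩
  f∧p + f¬p         ∎)
  where
  open ≤-Reasoning
  f∧p = count (λ x → f x ∧ p x)
  f¬p = count (λ x → f x ∧ not (p x))
  g∧p = count (λ x → g x ∧ p x)
  g¬p = count (λ x → g x ∧ not (p x))

deficit⇒surplus : ∀ {m} (f g p : Fin m → Bool) → count f ≡ count g →
  count (λ x → g x ∧ p x) ≤ count (λ x → f x ∧ p x) →
  count (λ x → f x ∧ not (p x)) ≤ count (λ x → g x ∧ not (p x))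
deficit⇒surplus f g p f≡g deficit = +-cancelˡ-≤ f∧p f¬p g¬p (begin
  f∧p + f¬p   ≡⟨ count-split f p ⟨
  count f     ≡⟨ f≡g ⟩
  count g     ≡⟨ count-split g p ⟩
  g∧p + g¬p   ≤⟨ +-monoˡ-≤ g¬p deficit ⟩
  f∧p + g¬p   ∎)
  where
  open ≤-Reasoning
  f∧p = count (λ x → f x ∧ p x)
  f¬p = count (λ x → f x ∧ not (p x))
  g∧p = count (λ x → g x ∧ p x)
  g¬p = count (λ x → g x ∧ not (p x))

∣p∣≡count : ∀ {m} (p : Subset m) → ∣ p ∣ ≡ count (lookup p)
∣p∣≡count []            = refl
∣p∣≡count (true  ∷ p) = cong suc (∣p∣≡count p)
∣p∣≡count (false ∷ p) = ∣p∣≡count p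

∉⇒lookup≡false : ∀ {m} {x : Fin m} {p : Subset m} → x ∉ p → lookup p x ≡ false
∉⇒lookup≡false {x = x} {p} x∉p with lookup p x in eq
... | true  = ⊥-elim (x∉p (lookup⇒[]= x p eq))
... | false = refl

does-∈? : ∀ {m} (x : Fin m) (p : Subset m) → does (x ∈? p) ≡ lookup p x
does-∈? zero    (true  ∷ p) = refl
does-∈? zero    (false ∷ p) = refl
does-∈? (suc x) (b ∷ p)     = does-∈? x p

lookup-─ : ∀ {m} (p q : Subset m) x → lookup (p ─ q) x ≡ lookup p x ∧ not (lookup q x)
lookup-─ (a ∷ p)     (b ∷ q)     (suc x) = lookup-─ p q x
lookup-─ (false ∷ p) (false ∷ q) zero    = refl
lookup-─ (false ∷ p) (true  ∷ q) zero    = refl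
lookup-─ (true  ∷ p) (false ∷ q) zero    = refl
lookup-─ (true  ∷ p) (true  ∷ q) zero    = refl

lookup-⁅x⁆-x : ∀ {m} (x : Fin m) → lookup ⁅ x ⁆ x ≡ true
lookup-⁅x⁆-x x = []=⇒lookup (x∈⁅x⁆ x)

lookup-⁅y⁆ : ∀ {m} (y x : Fin m) → x ≢ y → lookup ⁅ y ⁆ x ≡ false
lookup-⁅y⁆ y x x≢y = ∉⇒lookup≡false (x≢y⇒x∉⁅y⁆ x≢y)

lookup-exchange : ∀ {m} (p : Subset m) (i j x : Fin m) →
  lookup ((p - i) ∪ ⁅ j ⁆) x ≡ (lookup p x ∧ not (lookup ⁅ i ⁆ x)) ∨ lookup ⁅ j ⁆ x
lookup-exchange p i j x = trans (lookup-zipWith _∨_ x (p - i) ⁅ j ⁆) (cong (_∨ lookup ⁅ j ⁆ x) (lookup-─ p ⁅ i ⁆ x))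

lookup-injective : ∀ {m} (p q : Subset m) → (∀ x → lookup p x ≡ lookup q x) → p ≡ q
lookup-injective p q eq = trans (sym (tabulate∘lookup p)) (trans (tabulate-cong eq) (tabulate∘lookup q))

countBelow : ℕ → List ℕ → ℕ
countBelow v xs = length (filter (_<? v) xs)

countBelow-≥ : ∀ v xs → All (v ≤_) xs → countBelow v xs ≡ 0
countBelow-≥ v []       []         = refl
countBelow-≥ v (x ∷ xs) (v≤x ∷ vs) = trans (cong length (filter-reject (_<? v) (≤⇒≯ v≤x))) (countBelow-≥ v xs vs)

countBelow-< : ∀ v xs → All (_< v) xs → countBelow v xs ≡ length xs
countBelow-< v xs all< = cong length (filter-all (_<? v) all<)

countBelow-∷ : ∀ v x xs → countBelow v xs ≤ countBelow v (x ∷ xs)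
countBelow-∷ v x xs with does (x <? v)
... | true  = n≤1+n _
... | false = ≤-refl

countBelow-∷ʳ : ∀ {Q : ℕ → Set} (Q? : Decidable Q) v xs r →
  countBelow v (filter Q? (xs ++ [ r ])) ≡ countBelow v (filter Q? xs) + 𝟙 (does (Q? r) ∧ does (r <? v))
countBelow-∷ʳ Q? v [] r with does (Q? r)
... | false = refl
... | true with does (r <? v)
...   | true  = refl
...   | false = refl
countBelow-∷ʳ Q? v (x ∷ xs) r with does (Q? x)
... | false = countBelow-∷ʳ Q? v xs r
... | true with does (x <? v)
...   | true  = cong suc (countBelow-∷ʳ Q? v xs r)
...   | false = countBelow-∷ʳ Q? v xs r

pointwise-≤⇒countBelow-≥ : ∀ {xs ys} → Pointwise _≤_ xs ys → ∀ v → countBelow v ys ≤ countBelow v xs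
pointwise-≤⇒countBelow-≥ [] v = z≤n
pointwise-≤⇒countBelow-≥ {x ∷ xs} {y ∷ ys} (x≤y ∷ xs≤ys) v with does (y <? v) in y<v
... | false = ≤-trans (pointwise-≤⇒countBelow-≥ xs≤ys v) (countBelow-∷ v x xs)
... | true with does (x <? v) in x<v
...   | true  = s≤s (pointwise-≤⇒countBelow-≥ xs≤ys v)
...   | false = ⊥-elim (does-false⇒ (x <? v) x<v (≤-<-trans x≤y (does-true⇒ (y <? v) y<v)))

-- Heads are compared at v = x, tails at all other v.
countBelow-≥⇒pointwise-≤ : ∀ {xs ys} → AllPairs _<_ xs → AllPairs _<_ ys → length xs ≡ length ys →
  (∀ v → countBelow v ys ≤ countBelow v xs) → Pointwise _≤_ xs ys
countBelow-≥⇒pointwise-≤ {[]}     {[]}     _ _ _ _ = []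
countBelow-≥⇒pointwise-≤ {x ∷ xs} {y ∷ ys} (x<xs ∷ xs↑) (y<ys ∷ ys↑) len below =
  x≤y ∷ countBelow-≥⇒pointwise-≤ xs↑ ys↑ (suc-injective len) tails
  where
  x≤y : x ≤ y
  x≤y with does (y <? x) in y<x | below x
  ... | false | _  = ≮⇒≥ (does-false⇒ (y <? x) y<x)
  ... | true  | bx with does (x <? x) in x<x
  ...   | true  = ⊥-elim (<-irrefl refl (does-true⇒ (x <? x) x<x))
  ...   | false with () ← subst (suc (countBelow x ys) ≤_) (countBelow-≥ x xs (All.map <⇒≤ x<xs)) bx
  tails : ∀ v → countBelow v ys ≤ countBelow v xs
  tails v with does (y <? v) in y<v | below v
  ... | false | _ rewrite countBelow-≥ v ys (All.map (≤-trans (≮⇒≥ (does-false⇒ (y <? v) y<v)) ∘ <⇒≤) y<ys) = z≤n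
  ... | true  | bv with does (x <? v) in x<v
  ...   | true  = s≤s⁻¹ bv
  ...   | false = ⊥-elim (does-false⇒ (x <? v) x<v (≤-<-trans x≤y (does-true⇒ (y <? v) y<v)))

last-increasing : ∀ x xs → AllPairs _<_ (x ∷ xs) →
  Σ ℕ λ μ → last (x ∷ xs) ≡ just μ × μ ∈ₗ x ∷ xs × All (_≤ μ) (x ∷ xs)
last-increasing x []       _                  = x , refl , here refl , (≤-refl ∷ [])
last-increasing x (y ∷ ys) ((x<y ∷ _) ∷ y∷ys↑) with last-increasing y ys y∷ys↑
... | μ , last≡μ , μ∈ , y≤μ ∷ ys≤μ = μ , last≡μ , there μ∈ , ≤-trans (<⇒≤ x<y) y≤μ ∷ y≤μ ∷ ys≤μ

filter-map : ∀ {A : Set} {Q : A → Set} (Q? : Decidable Q) (f : ℕ → A) xs →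
  filter Q? (map f xs) ≡ map f (filter (Q? ∘ f) xs)
filter-map Q? f []       = refl
filter-map Q? f (x ∷ xs) with does (Q? (f x))
... | true  = cong (f x ∷_) (filter-map Q? f xs)
... | false = filter-map Q? f xs

-- The Gale order via prefix counts

module Gale {n : ℕ} where
  open Cyclic {n}

  prefix : Fin N → ℕ → Fin N → Bool
  prefix t v x = does (rank t x <? v)

  prefix⁺ : ∀ t {v} x → rank t x < v → prefix t v x ≡ true
  prefix⁺ t {v} x = dec-true (rank t x <? v)

  prefix⁻ : ∀ t v x → prefix t v x ≡ true → rank t x < v
  prefix⁻ t v x = does-true⇒ (rank t x <? v)

  ¬prefix⁻ : ∀ t v x → prefix t v x ≡ false → v ≤ rank t x
  ¬prefix⁻ t v x eq = ≮⇒≥ (does-false⇒ (rank t x <? v) eq)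

  ranks : Fin N → Subset N → List ℕ
  ranks t A = filter (λ i → rot t i ∈? A) (upTo N)

  ranks<N : ∀ t A → All (_< N) (ranks t A)
  ranks<N t A = All.filter⁺ (λ i → rot t i ∈? A) (all-upTo N)

  ranks-increasing : ∀ t A → AllPairs _<_ (ranks t A)
  ranks-increasing t A = AllPairs.filter⁺ (λ i → rot t i ∈? A) (AllPairs.applyUpTo⁺₁ (λ i → i) N (λ i<j _ → i<j))

  sortedₜ≡map-rot-ranks : ∀ t A → sortedₜ t A ≡ map (rot t) (ranks t A)
  sortedₜ≡map-rot-ranks t A = filter-map (_∈? A) (rot t) (upTo N)

  countBelow-ranks : ∀ t A v → countBelow v (ranks t A) ≡ count (λ x → lookup A x ∧ prefix t v x)
  countBelow-ranks t A v = trans (go N ≤-refl)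
    (count-cong _ _ (λ x → ∧-trueʳ (lookup A x ∧ prefix t v x) (prefix⁺ t x (rank<N t x))))
    where
    A? = λ i → rot t i ∈? A
    go : ∀ r → r ≤ N → countBelow v (filter A? (upTo r)) ≡ count (λ x → (lookup A x ∧ prefix t v x) ∧ prefix t r x)
    go zero    _   = sym (count-false _ (λ x → ∧-falseʳ (lookup A x ∧ prefix t v x) (dec-false (rank t x <? 0) λ ())))
    go (suc r) r<N = begin
      countBelow v (filter A? (upTo (suc r)))                  ≡⟨ cong (λ l → countBelow v (filter A? l)) (upTo-∷ʳ r) ⟨
      countBelow v (filter A? (upTo r ++ [ r ]))               ≡⟨ countBelow-∷ʳ A? v (upTo r) r ⟩
      countBelow v (filter A? (upTo r)) + 𝟙 (does (A? r) ∧ does (r <? v))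
        ≡⟨ cong₂ _+_ (go r (<⇒≤ r<N)) (cong (λ b → 𝟙 (b ∧ does (r <? v))) (does-∈? y A)) ⟩
      count f + 𝟙 (lookup A y ∧ does (r <? v))                 ≡⟨ +-comm (count f) _ ⟩
      𝟙 (lookup A y ∧ does (r <? v)) + count f                 ≡⟨ cong (λ b → 𝟙 b + count f) gy ⟨
      𝟙 (g y) + count f                                        ≡⟨ count-insert f g y f≡g fy ⟨
      count g                                                  ∎
      where
      open ≡-Reasoning
      y = rot t r
      f g : Fin N → Bool
      f x = (lookup A x ∧ prefix t v x) ∧ prefix t r x
      g x = (lookup A x ∧ prefix t v x) ∧ prefix t (suc r) x
      rank-y : rank t y ≡ r
      rank-y = rank-rot t r<N
      gy : g y ≡ lookup A y ∧ does (r <? v)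
      gy rewrite rank-y = ∧-trueʳ _ (dec-true (r <? suc r) (n<1+n r))
      fy : f y ≡ false
      fy rewrite rank-y = ∧-falseʳ _ (dec-false (r <? r) (<-irrefl refl))
      f≡g : ∀ x → x ≢ y → f x ≡ g x
      f≡g x x≢y = cong ((lookup A x ∧ prefix t v x) ∧_)
        (sym (<?-suc-≢ (rank t x) r (x≢y ∘ rank-injective t ∘ λ x≡r → trans x≡r (sym rank-y))))

  length-ranks : ∀ t A → length (ranks t A) ≡ count (lookup A)
  length-ranks t A = begin
    length (ranks t A)                            ≡⟨ countBelow-< N (ranks t A) (ranks<N t A) ⟨
    countBelow N (ranks t A)                      ≡⟨ countBelow-ranks t A N ⟩
    count (λ x → lookup A x ∧ prefix t N x)       ≡⟨ count-cong _ _ (λ x → ∧-trueʳ (lookup A x) (prefix⁺ t x (rank<N t x))) ⟩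
    count (lookup A)                              ∎
    where open ≡-Reasoning

  rank∈ranks : ∀ t D {x} → x ∈ D → rank t x ∈ₗ ranks t D
  rank∈ranks t D {x} x∈D = ∈-filter⁺ (λ i → rot t i ∈? D) (∈-upTo⁺ (rank<N t x)) (subst (_∈ D) (sym (rot-rank t x)) x∈D)

  maxₜ-spec : ∀ a D {y} → y ∈ D →
    Σ (Fin N) λ m → maxₜ a D ≡ just m × m ∈ D × (∀ {x} → x ∈ D → rank a x ≤ rank a m)
  maxₜ-spec a D {y} y∈D with ranks a D in ranks≡ | rank∈ranks a D y∈D
  ... | []     | ()
  ... | r ∷ rs | _ with last-increasing r rs (subst (AllPairs _<_) ranks≡ (ranks-increasing a D))
  ...   | μ , last≡μ , μ∈ , rs≤μ = rot a μ , max≡ , m∈D , maximal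
    where
    μ∈ranks : μ ∈ₗ ranks a D
    μ∈ranks = subst (μ ∈ₗ_) (sym ranks≡) μ∈
    max≡ : maxₜ a D ≡ just (rot a μ)
    max≡ = begin
      last (sortedₜ a D)              ≡⟨ cong last (sortedₜ≡map-rot-ranks a D) ⟩
      last (map (rot a) (ranks a D))  ≡⟨ cong (λ l → last (map (rot a) l)) ranks≡ ⟩
      last (map (rot a) (r ∷ rs))     ≡⟨ last-map (rot a) (r ∷ rs) ⟩
      Maybe.map (rot a) (last (r ∷ rs)) ≡⟨ cong (Maybe.map (rot a)) last≡μ ⟩
      just (rot a μ)                  ∎
      where open ≡-Reasoning
    m∈D : rot a μ ∈ D
    m∈D = proj₂ (∈-filter⁻ (λ i → rot a i ∈? D) μ∈ranks)
    maximal : ∀ {x} → x ∈ D → rank a x ≤ rank a (rot a μ)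
    maximal x∈D = subst (_ ≤_) (sym (rank-rot a (∈-upTo⁻ (proj₁ (∈-filter⁻ (λ i → rot a i ∈? D) μ∈ranks)))))
      (All.lookup rs≤μ (subst (_ ∈ₗ_) ranks≡ (rank∈ranks a D x∈D)))

  _≼[_]_ : Subset N → Fin N → Subset N → Set
  A ≼[ t ] B = ∀ v → count (λ x → lookup B x ∧ prefix t v x) ≤ count (λ x → lookup A x ∧ prefix t v x)

  private
    ranks-pointwise⁻ : ∀ t {xs ys} → All (_< N) xs → All (_< N) ys →
      Pointwise (λ a b → rot t a ≤[ t ] rot t b) xs ys → Pointwise _≤_ xs ys
    ranks-pointwise⁻ t []           []           []         = []
    ranks-pointwise⁻ t (x<N ∷ xs<N) (y<N ∷ ys<N) (r ∷ rs) =
      subst₂ _≤_ (rank-rot t x<N) (rank-rot t y<N) r ∷ ranks-pointwise⁻ t xs<N ys<N rs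

    ranks-pointwise⁺ : ∀ t {xs ys} → All (_< N) xs → All (_< N) ys →
      Pointwise _≤_ xs ys → Pointwise (λ a b → rot t a ≤[ t ] rot t b) xs ys
    ranks-pointwise⁺ t []           []           []         = []
    ranks-pointwise⁺ t (x<N ∷ xs<N) (y<N ∷ ys<N) (r ∷ rs) =
      subst₂ _≤_ (sym (rank-rot t x<N)) (sym (rank-rot t y<N)) r ∷ ranks-pointwise⁺ t xs<N ys<N rs

  ⊑⇒≼ : ∀ t A B → A ⊑[ t ] B → A ≼[ t ] B × count (lookup A) ≡ count (lookup B)
  ⊑⇒≼ t A B A⊑B = ≼ , trans (sym (length-ranks t A)) (trans (Pointwise-length ranks≤) (length-ranks t B))
    where
    ranks≤ : Pointwise _≤_ (ranks t A) (ranks t B)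
    ranks≤ = ranks-pointwise⁻ t (ranks<N t A) (ranks<N t B) (Pointwise.map⁻ (rot t) (rot t)
      (subst₂ (Pointwise _≤[ t ]_) (sortedₜ≡map-rot-ranks t A) (sortedₜ≡map-rot-ranks t B) A⊑B))
    ≼ : A ≼[ t ] B
    ≼ v = subst₂ _≤_ (countBelow-ranks t B v) (countBelow-ranks t A v) (pointwise-≤⇒countBelow-≥ ranks≤ v)

  ≼⇒⊑ : ∀ t A B → count (lookup A) ≡ count (lookup B) → A ≼[ t ] B → A ⊑[ t ] B
  ≼⇒⊑ t A B |A|≡|B| A≼B =
    subst₂ (Pointwise _≤[ t ]_) (sym (sortedₜ≡map-rot-ranks t A)) (sym (sortedₜ≡map-rot-ranks t B))
      (Pointwise.map⁺ (rot t) (rot t) (ranks-pointwise⁺ t (ranks<N t A) (ranks<N t B) ranks≤))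
    where
    ranks≤ : Pointwise _≤_ (ranks t A) (ranks t B)
    ranks≤ = countBelow-≥⇒pointwise-≤ (ranks-increasing t A) (ranks-increasing t B)
      (trans (length-ranks t A) (trans |A|≡|B| (sym (length-ranks t B))))
      (λ v → subst₂ _≤_ (sym (countBelow-ranks t B v)) (sym (countBelow-ranks t A v)) (A≼B v))

  count-prefix-suc-rank : ∀ a (f : Fin N → Bool) x →
    count (λ z → f z ∧ prefix a (suc (rank a x)) z) ≡ 𝟙 (f x) + count (λ z → f z ∧ prefix a (rank a x) z)
  count-prefix-suc-rank a f x =
    trans (count-insert (λ z → f z ∧ prefix a r z) (λ z → f z ∧ prefix a (suc r) z) x agree fx)
          (cong (λ b → 𝟙 b + count (λ z → f z ∧ prefix a r z)) (∧-trueʳ (f x) (dec-true (r <? suc r) (n<1+n r))))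
    where
    r = rank a x
    agree : ∀ z → z ≢ x → f z ∧ prefix a r z ≡ f z ∧ prefix a (suc r) z
    agree z z≢x = cong (f z ∧_) (sym (<?-suc-≢ (rank a z) r (z≢x ∘ rank-injective a)))
    fx : f x ∧ prefix a r x ≡ false
    fx = ∧-falseʳ (f x) (dec-false (r <? r) (<-irrefl refl))

  count-¬prefix-rank : ∀ a (f : Fin N → Bool) x →
    count (λ z → f z ∧ not (prefix a (rank a x) z)) ≡ 𝟙 (f x) + count (λ z → f z ∧ not (prefix a (suc (rank a x)) z))
  count-¬prefix-rank a f x =
    trans (count-insert (λ z → f z ∧ not (prefix a (suc r) z)) (λ z → f z ∧ not (prefix a r z)) x agree fx)
          (cong (λ b → 𝟙 b + count (λ z → f z ∧ not (prefix a (suc r) z)))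
                (∧-trueʳ (f x) (cong not (dec-false (r <? r) (<-irrefl refl)))))
    where
    r = rank a x
    agree : ∀ z → z ≢ x → f z ∧ not (prefix a (suc r) z) ≡ f z ∧ not (prefix a r z)
    agree z z≢x = cong (λ b → f z ∧ not b) (<?-suc-≢ (rank a z) r (z≢x ∘ rank-injective a))
    fx : f x ∧ not (prefix a (suc r) x) ≡ false
    fx = ∧-falseʳ (f x) (cong not (dec-true (r <? suc r) (n<1+n r)))

  private
    [N∸r+v]+r≡v+N : ∀ {r} v → r < N → N ∸ r + v + r ≡ v + N
    [N∸r+v]+r≡v+N {r} v r<N =
      trans (cong (_+ r) (+-comm (N ∸ r) v)) (trans (+-assoc v (N ∸ r) r) (cong (v +_) (m∸n+n≡m (<⇒≤ r<N))))

  -- The positions v, …, J - 1 of ≤_a, where J is the rank of j, are the last J - v positions of ≤_j.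
  ¬prefix-∧-prefix-rank : ∀ a j v → v ≤ rank a j → ∀ x →
    not (prefix a v x) ∧ prefix a (rank a j) x ≡ not (prefix j (N ∸ rank a j + v) x)
  ¬prefix-∧-prefix-rank a j v v≤J x with does (rank a x <? rank a j) in x<J?
  ... | true rewrite ∧-identityʳ (not (prefix a v x)) = cong not (does-⇔ (mk⇔ to from) (rank a x <? v) (rank j x <? v′))
    where
    J = rank a j
    v′ = N ∸ J + v
    v′+J≡v+N : v′ + J ≡ v + N
    v′+J≡v+N = [N∸r+v]+r≡v+N v (rank<N a j)
    wrap : rank j x + J ≡ rank a x + N
    wrap = rank-rebase-wrap a j x (does-true⇒ (rank a x <? J) x<J?)
    to : rank a x < v → rank j x < v′
    to x<v = +-cancelʳ-< J (rank j x) v′ (subst₂ _<_ (sym wrap) (sym v′+J≡v+N) (+-monoˡ-< N x<v))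
    from : rank j x < v′ → rank a x < v
    from x<v′ = +-cancelʳ-< N (rank a x) v (subst₂ _<_ wrap v′+J≡v+N (+-monoˡ-< J x<v′))
  ... | false rewrite ∧-zeroʳ (not (prefix a v x)) = sym (cong not (dec-true (rank j x <? N ∸ J + v) x<v′))
    where
    J = rank a j
    shift : rank j x + J ≡ rank a x
    shift = rank-rebase a j x (≮⇒≥ (does-false⇒ (rank a x <? J) x<J?))
    x<v′ : rank j x < N ∸ J + v
    x<v′ = +-cancelʳ-< J (rank j x) (N ∸ J + v)
      (subst₂ _<_ (sym shift) (sym ([N∸r+v]+r≡v+N v (rank<N a j))) (<-≤-trans (rank<N a x) (m≤n+m N v)))

  ≼-antisym : ∀ a A B → A ≼[ a ] B → B ≼[ a ] A → A ≡ B
  ≼-antisym a A B A≼B B≼A = lookup-injective A B λ x → 𝟙-injective _ _ (+-cancelʳ-≡ _ _ _ (begin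
    𝟙 (lookup A x) + #A (rank a x)   ≡⟨ count-prefix-suc-rank a (lookup A) x ⟨
    #A (suc (rank a x))              ≡⟨ #A≡#B (suc (rank a x)) ⟩
    #B (suc (rank a x))              ≡⟨ count-prefix-suc-rank a (lookup B) x ⟩
    𝟙 (lookup B x) + #B (rank a x)   ≡⟨ cong (𝟙 (lookup B x) +_) (#A≡#B (rank a x)) ⟨
    𝟙 (lookup B x) + #A (rank a x)   ∎))
    where
    open ≡-Reasoning
    #A #B : ℕ → ℕ
    #A v = count (λ x → lookup A x ∧ prefix a v x)
    #B v = count (λ x → lookup B x ∧ prefix a v x)
    #A≡#B : ∀ v → #A v ≡ #B v
    #A≡#B v = ≤-antisym (B≼A v) (A≼B v)

-- Grassmann necklaces

module Necklace {n : ℕ} (k : ℕ) (I : Fin (suc n) → Subset (suc n)) (isNecklace : IsGrassmannNecklace (suc n) k I) where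
  open Cyclic {n}
  open Gale {n}

  necklace-keeps : ∀ i x → x ≢ i → lookup (I i) x ≡ true → lookup (I (next i)) x ≡ true
  necklace-keeps i x x≢i x∈Ii with i ∈? I i
  ... | no i∉Ii rewrite proj₂ (proj₂ isNecklace i) i∉Ii = x∈Ii
  ... | yes i∈Ii with proj₁ (proj₂ isNecklace i) i∈Ii
  ...   | j , Ii+1≡ rewrite Ii+1≡ | lookup-exchange (I i) i j x | lookup-⁅y⁆ i x x≢i | x∈Ii = refl

  necklace-persists : ∀ s t x → lookup (I s) x ≡ true → rank s t ≤ rank s x → lookup (I t) x ≡ true
  necklace-persists s t x x∈Is t≤x = subst (λ i → lookup (I i) x ≡ true) (rot-rank s t) (walk (rank s t) t≤x)
    where
    walk : ∀ d → d ≤ rank s x → lookup (I (rot s d)) x ≡ true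
    walk zero    _   = subst (λ i → lookup (I i) x ≡ true) (sym (rot-zero s)) x∈Is
    walk (suc d) d<x = subst (λ i → lookup (I i) x ≡ true) (next-rot s d) (necklace-keeps (rot s d) x x≢s+d (walk d (<⇒≤ d<x)))
      where
      x≢s+d : x ≢ rot s d
      x≢s+d refl = <-irrefl (sym (rank-rot s (<-trans d<x (rank<N s x)))) d<x

  -- Passing from I i to I (next i) exchanges i for some j, so it cannot increase a count over a set containing i.
  necklace-step-count : ∀ i (S : Fin N → Bool) → S i ≡ true →
    count (λ x → lookup (I (next i)) x ∧ S x) ≤ count (λ x → lookup (I i) x ∧ S x)
  necklace-step-count i S Si with i ∈? I i
  ... | no i∉Ii rewrite proj₂ (proj₂ isNecklace i) i∉Ii = ≤-refl
  ... | yes i∈Ii with proj₁ (proj₂ isNecklace i) i∈Ii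
  ...   | j , Ii+1≡ rewrite Ii+1≡ = ≤-trans (count≤suc new (remove i old) j new⇒old) (≤-reflexive (sym (count-remove old i old-i)))
    where
    old new : Fin N → Bool
    old x = lookup (I i) x ∧ S x
    new x = lookup ((I i - i) ∪ ⁅ j ⁆) x ∧ S x
    old-i : old i ≡ true
    old-i = cong₂ _∧_ ([]=⇒lookup i∈Ii) Si
    new⇒old : ∀ x → x ≢ j → new x ≡ true → remove i old x ≡ true
    new⇒old x x≢j newx with x ≟ i
    ... | yes refl rewrite lookup-exchange (I i) i j i | lookup-⁅x⁆-x i | lookup-⁅y⁆ j i x≢j | ∧-zeroʳ (lookup (I i) i)
      with () ← newx
    ... | no x≢i rewrite lookup-exchange (I i) i j x | lookup-⁅y⁆ i x x≢i | lookup-⁅y⁆ j x x≢j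
                       | ∧-identityʳ (lookup (I i) x) | ∨-identityʳ (lookup (I i) x) = newx

  module _ (t : Fin N) (v : ℕ) where
    private
      #_ : Fin N → ℕ
      # i = count (λ x → lookup (I i) x ∧ prefix t v x)

    necklace-≼-early : ∀ s → rank t s < v → # s ≤ # t
    necklace-≼-early s s<v = subst (λ i → # i ≤ # t) (rot-rank t s) (walk (rank t s) s<v (rank<N t s))
      where
      walk : ∀ e → e < v → e < N → # rot t e ≤ # t
      walk zero    _   _   rewrite rot-zero t = ≤-refl
      walk (suc e) e<v e<N = ≤-trans
        (subst (λ i → # i ≤ # rot t e) (next-rot t e)
          (necklace-step-count (rot t e) (prefix t v) (prefix⁺ t (rot t e) (subst (_< v) (sym (rank-rot t e<N′)) e<v′))))
        (walk e e<v′ e<N′)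
        where
        e<v′ = <-trans (n<1+n e) e<v
        e<N′ = <-trans (n<1+n e) e<N

    -- An element of I s in the first v positions of ≤_t survives the walk from s around to t.
    necklace-≼-late : ∀ s → v ≤ rank t s → # s ≤ # t
    necklace-≼-late s v≤s = count-mono (λ x → lookup (I s) x ∧ prefix t v x) (λ x → lookup (I t) x ∧ prefix t v x) Is⇒It
      where
      Is⇒It : ∀ x → lookup (I s) x ∧ prefix t v x ≡ true → lookup (I t) x ∧ prefix t v x ≡ true
      Is⇒It x x∈ = ∧-true⁺ (necklace-persists s t x (∧-true⁻ˡ x∈) t≤x) (∧-true⁻ʳ x∈)
        where
        open ≤-Reasoning
        x<s : rank t x < rank t s
        x<s = <-≤-trans (prefix⁻ t v x (∧-true⁻ʳ x∈)) v≤s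
        t<s : rank t t < rank t s
        t<s = subst (_< rank t s) (sym (rank-self t)) (≤-<-trans z≤n x<s)
        t≤x : rank s t ≤ rank s x
        t≤x = +-cancelʳ-≤ (rank t s) (rank s t) (rank s x) (begin
          rank s t + rank t s   ≡⟨ rank-rebase-wrap t s t t<s ⟩
          rank t t + N          ≡⟨ cong (_+ N) (rank-self t) ⟩
          N                     ≤⟨ m≤n+m N (rank t x) ⟩
          rank t x + N          ≡⟨ rank-rebase-wrap t s x x<s ⟨
          rank s x + rank t s   ∎)

  necklace-≼ : ∀ t s → I t ≼[ t ] I s
  necklace-≼ t s v with rank t s <? v
  ... | yes s<v = necklace-≼-early t v s s<v
  ... | no  s≮v = necklace-≼-late t v s (≮⇒≥ s≮v)

-- Restricting a positroid to the sets containing j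

module Restriction {n : ℕ} (k : ℕ) (M : Subset (suc n) → Set) (I K : Fin (suc n) → Subset (suc n)) (j : Fin (suc n))
  (isPositroid : IsPositroidWithNecklace (suc n) k M I) (j∈Ij : j ∈ I j)
  (isRestriction : IsPositroidWithNecklace (suc n) k (λ H → M H × j ∈ H) K) where
  open Cyclic {n}
  open Gale {n}
  open Necklace k I (proj₁ isPositroid)
    using (necklace-persists) renaming (necklace-≼ to I-≼)
  open Necklace k K (proj₁ isRestriction)
    using () renaming (necklace-≼ to K-≼)

  size-I : ∀ t → count (lookup (I t)) ≡ k
  size-I t = trans (sym (∣p∣≡count (I t))) (proj₁ (proj₁ isPositroid) t)

  size-K : ∀ t → count (lookup (K t)) ≡ k
  size-K t = trans (sym (∣p∣≡count (K t))) (proj₁ (proj₁ isRestriction) t)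

  ∈M : ∀ H → count (lookup H) ≡ k → (∀ t → I t ≼[ t ] H) → M H
  ∈M H |H|≡k I≼H = proj₂ (proj₂ isPositroid H)
    (trans (∣p∣≡count H) |H|≡k , λ t → ≼⇒⊑ t (I t) H (trans (size-I t) (sym |H|≡k)) (I≼H t))

  ∈M⇒size : ∀ H → M H → count (lookup H) ≡ k
  ∈M⇒size H H∈M = trans (sym (∣p∣≡count H)) (proj₁ (proj₁ (proj₂ isPositroid H) H∈M))

  ∈M⇒≼ : ∀ H → M H → ∀ t → I t ≼[ t ] H
  ∈M⇒≼ H H∈M t = proj₁ (⊑⇒≼ t (I t) H (proj₂ (proj₁ (proj₂ isPositroid H) H∈M) t))

  ∈M′⇒≼ : ∀ H → M H → j ∈ H → ∀ t → K t ≼[ t ] H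
  ∈M′⇒≼ H H∈M j∈H t = proj₁ (⊑⇒≼ t (K t) H (proj₂ (proj₁ (proj₂ isRestriction H) (H∈M , j∈H)) t))

  K∈M′ : ∀ a → M (K a) × j ∈ K a
  K∈M′ a = proj₂ (proj₂ isRestriction (K a))
    (proj₁ (proj₁ isRestriction) a , λ t → ≼⇒⊑ t (K t) (K a) (trans (size-K t) (sym (size-K a))) (K-≼ t a))

  K≡I : ∀ a → j ∈ I a → K a ≡ I a
  K≡I a j∈Ia = ≼-antisym a (K a) (I a)
    (∈M′⇒≼ (I a) (∈M (I a) (size-I a) (λ t → I-≼ t a)) j∈Ia a)
    (∈M⇒≼ (K a) (proj₁ (K∈M′ a)) a)

  module Exchange (a : Fin N) (j∉Ia : j ∉ I a) (m : Fin N) (m∈Ia─Ij : m ∈ I a ─ I j)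
    (m-max : ∀ {x} → x ∈ I a ─ I j → rank a x ≤ rank a m) where

    Ia Ij : Fin N → Bool
    Ia = lookup (I a)
    Ij = lookup (I j)

    J μ : ℕ
    J = rank a j
    μ = rank a m

    j∉Ia′ : Ia j ≡ false
    j∉Ia′ = ∉⇒lookup≡false j∉Ia

    m∈Ia : Ia m ≡ true
    m∈Ia = ∧-true⁻ˡ (trans (sym (lookup-─ (I a) (I j) m)) ([]=⇒lookup m∈Ia─Ij))

    m∉Ij : Ij m ≡ false
    m∉Ij = not-true⁻ (∧-true⁻ʳ (trans (sym (lookup-─ (I a) (I j) m)) ([]=⇒lookup m∈Ia─Ij)))

    j∈Ij′ : Ij j ≡ true
    j∈Ij′ = []=⇒lookup j∈Ij

    m≢j : m ≢ j
    m≢j refl = true-false-conflict j∈Ij′ m∉Ij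

    μ<J : μ < J
    μ<J = ≰⇒> (λ J≤μ → true-false-conflict (necklace-persists a j m m∈Ia J≤μ) m∉Ij)

    after-m⇒∈Ij : ∀ x → Ia x ≡ true → μ < rank a x → Ij x ≡ true
    after-m⇒∈Ij x x∈Ia m<x with Ij x in x∈Ij
    ... | true  = refl
    ... | false = ⊥-elim (<⇒≱ m<x (m-max (lookup⇒[]= x (I a ─ I j)
                    (trans (lookup-─ (I a) (I j) x) (cong₂ _∧_ x∈Ia (cong not x∈Ij))))))

    X : Subset N
    X = (I a - m) ∪ ⁅ j ⁆

    Xb : Fin N → Bool
    Xb = lookup X

    j∈X : Xb j ≡ true
    j∈X rewrite lookup-exchange (I a) m j j | lookup-⁅x⁆-x j = ∨-zeroʳ _

    m∉X : Xb m ≡ false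
    m∉X rewrite lookup-exchange (I a) m j m | lookup-⁅x⁆-x m | lookup-⁅y⁆ j m m≢j | ∧-zeroʳ (Ia m) = refl

    Ia⇒X : ∀ x → Ia x ≡ true → x ≢ m → Xb x ≡ true
    Ia⇒X x x∈Ia x≢m rewrite lookup-exchange (I a) m j x | lookup-⁅y⁆ m x x≢m | x∈Ia = refl

    X⇒Ia : ∀ x → Xb x ≡ true → x ≢ j → Ia x ≡ true × x ≢ m
    X⇒Ia x x∈X x≢j rewrite lookup-exchange (I a) m j x | lookup-⁅y⁆ j x x≢j | ∨-identityʳ (Ia x ∧ not (lookup ⁅ m ⁆ x)) =
      ∧-true⁻ˡ x∈X , λ { refl → true-false-conflict (lookup-⁅x⁆-x m) (not-true⁻ (∧-true⁻ʳ x∈X)) }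

    Ia≡X : ∀ x → x ≢ m → x ≢ j → Ia x ≡ Xb x
    Ia≡X x x≢m x≢j rewrite lookup-exchange (I a) m j x | lookup-⁅y⁆ m x x≢m | lookup-⁅y⁆ j x x≢j
      = sym (trans (∨-identityʳ _) (∧-identityʳ (Ia x)))

    size-X : count Xb ≡ k
    size-X = trans (sym (count-swap Ia Xb m j m∈Ia j∉Ia′ m∉X j∈X Ia≡X)) (size-I a)

    count-Ia≡count-X : ∀ (W : Fin N → Bool) → W m ≡ true → W j ≡ true →
      count (λ x → Ia x ∧ W x) ≡ count (λ x → Xb x ∧ W x)
    count-Ia≡count-X W Wm Wj = count-swap (λ x → Ia x ∧ W x) (λ x → Xb x ∧ W x) m j
      (∧-true⁺ m∈Ia Wm) (cong (_∧ W j) j∉Ia′) (cong (_∧ W m) m∉X) (∧-true⁺ j∈X Wj)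
      (λ x x≢m x≢j → cong (_∧ W x) (Ia≡X x x≢m x≢j))

    module _ (t : Fin N) (v : ℕ) where
      private
        W = prefix t v
        #_∧W : (Fin N → Bool) → ℕ
        # f ∧W = count (λ x → f x ∧ W x)

      I≼X-j-late : v ≤ rank t j → # Xb ∧W ≤ # lookup (I t) ∧W
      I≼X-j-late v≤j = ≤-trans (count-mono (λ x → Xb x ∧ W x) (λ x → Ia x ∧ W x) X⇒Ia′) (I-≼ t a v)
        where
        X⇒Ia′ : ∀ x → Xb x ∧ W x ≡ true → Ia x ∧ W x ≡ true
        X⇒Ia′ x x∈ =
          ∧-true⁺ (proj₁ (X⇒Ia x (∧-true⁻ˡ x∈) λ { refl → <⇒≱ (prefix⁻ t v x (∧-true⁻ʳ x∈)) v≤j })) (∧-true⁻ʳ x∈)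

      I≼X-j-m-early : rank t j < v → rank t m < v → # Xb ∧W ≤ # lookup (I t) ∧W
      I≼X-j-m-early j<v m<v = ≤-trans (≤-reflexive (sym (count-Ia≡count-X W (prefix⁺ t m m<v) (prefix⁺ t j j<v)))) (I-≼ t a v)

      -- Outside the prefix, elements of I t persist to I a and avoid m; compare complements.
      I≼X-a-early : rank t j < v → v ≤ rank t m → rank t a ≤ v → # Xb ∧W ≤ # lookup (I t) ∧W
      I≼X-a-early j<v v≤m a≤v = subst (_≤ # lookup (I t) ∧W) (+-identityʳ _)
        (surplus⇒deficit (lookup (I t)) Xb W 0 (trans (size-I t) (sym size-X))
          (subst (_≤ count (λ x → Xb x ∧ not (W x))) (sym (+-identityʳ _))
            (count-mono (λ x → lookup (I t) x ∧ not (W x)) (λ x → Xb x ∧ not (W x)) It⇒X)))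
        where
        m∉It : lookup (I t) m ≡ false
        m∉It with lookup (I t) m in m∈It
        ... | false = refl
        ... | true  = true-false-conflict (necklace-persists t j m m∈It (<⇒≤ (<-≤-trans j<v v≤m))) m∉Ij
        It⇒X : ∀ x → lookup (I t) x ∧ not (W x) ≡ true → Xb x ∧ not (W x) ≡ true
        It⇒X x x∈ = ∧-true⁺ (Ia⇒X x x∈Ia λ { refl → true-false-conflict (∧-true⁻ˡ x∈) m∉It }) (∧-true⁻ʳ x∈)
          where
          x∈Ia : Ia x ≡ true
          x∈Ia = necklace-persists t a x (∧-true⁻ˡ x∈) (≤-trans a≤v (¬prefix⁻ t v x (not-true⁻ (∧-true⁻ʳ x∈))))

      -- Inside the prefix, elements of X other than j come after m in ≤_a, hence lie in I j.
      I≼X-a-late : rank t j < v → v ≤ rank t m → v < rank t a → # Xb ∧W ≤ # lookup (I t) ∧W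
      I≼X-a-late j<v v≤m v<a = ≤-trans (count-mono (λ x → Xb x ∧ W x) (λ x → Ij x ∧ W x) X⇒Ij) (I-≼ t j v)
        where
        m<x : ∀ x → rank t x < v → μ < rank a x
        m<x x x<v with rank t m <? rank t a
        ... | yes m<a = ⊥-elim (<-asym μ<J (+-cancelʳ-< (rank t a) J μ
                (subst₂ _<_ (sym (rank-rebase-wrap t a j (<-trans j<v v<a))) (sym (rank-rebase-wrap t a m m<a))
                  (+-monoˡ-< N (<-≤-trans j<v v≤m)))))
        ... | no m≮a = +-cancelʳ-< (rank t a) μ (rank a x)
                (subst₂ _<_ (sym (rank-rebase t a m (≮⇒≥ m≮a))) (sym (rank-rebase-wrap t a x (<-trans x<v v<a)))
                  (<-≤-trans (rank<N t m) (m≤n+m N (rank t x))))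
        X⇒Ij : ∀ x → Xb x ∧ W x ≡ true → Ij x ∧ W x ≡ true
        X⇒Ij x x∈ with x ≟ j
        ... | yes refl = ∧-true⁺ j∈Ij′ (∧-true⁻ʳ x∈)
        ... | no x≢j   =
          ∧-true⁺ (after-m⇒∈Ij x (proj₁ (X⇒Ia x (∧-true⁻ˡ x∈) x≢j)) (m<x x (prefix⁻ t v x (∧-true⁻ʳ x∈)))) (∧-true⁻ʳ x∈)

    I≼X : ∀ t → I t ≼[ t ] X
    I≼X t v with rank t j <? v | rank t m <? v | v <? rank t a
    ... | no j≮v  | _        | _       = I≼X-j-late t v (≮⇒≥ j≮v)
    ... | yes j<v | yes m<v  | _       = I≼X-j-m-early t v j<v m<v
    ... | yes j<v | no m≮v   | no v≮a  = I≼X-a-early t v j<v (≮⇒≥ m≮v) (≮⇒≥ v≮a)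
    ... | yes j<v | no m≮v   | yes v<a = I≼X-a-late t v j<v (≮⇒≥ m≮v) v<a

    module _ (H : Subset N) (H∈M : M H) (j∈H : j ∈ H) where
      private
        Hb = lookup H
        I≼H = ∈M⇒≼ H H∈M
        |Ia|≡|H| : count Ia ≡ count Hb
        |Ia|≡|H| = trans (size-I a) (sym (∈M⇒size H H∈M))

      X≼H-m-late : ∀ v → v ≤ μ → count (λ x → Hb x ∧ prefix a v x) ≤ count (λ x → Xb x ∧ prefix a v x)
      X≼H-m-late v v≤μ = ≤-trans (I≼H a v) (count-mono (λ x → Ia x ∧ prefix a v x) (λ x → Xb x ∧ prefix a v x) Ia⇒X′)
        where
        Ia⇒X′ : ∀ x → Ia x ∧ prefix a v x ≡ true → Xb x ∧ prefix a v x ≡ true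
        Ia⇒X′ x x∈ =
          ∧-true⁺ (Ia⇒X x (∧-true⁻ˡ x∈) λ { refl → <⇒≱ (prefix⁻ a v m (∧-true⁻ʳ x∈)) v≤μ }) (∧-true⁻ʳ x∈)

      X≼H-m-j-early : ∀ v → μ < v → J < v → count (λ x → Hb x ∧ prefix a v x) ≤ count (λ x → Xb x ∧ prefix a v x)
      X≼H-m-j-early v μ<v J<v =
        ≤-trans (I≼H a v) (≤-reflexive (count-Ia≡count-X (prefix a v) (prefix⁺ a m μ<v) (prefix⁺ a j J<v)))

      -- The prefix contains m but not j, so in it X has one element fewer than I a; H makes up for that outside.
      module _ (v : ℕ) (μ<v : μ < v) (v≤J : v ≤ J) where
        private
          W q : Fin N → Bool
          W = prefix a v
          q = prefix a J

        before-j : count (λ x → (Ia x ∧ not (W x)) ∧ q x) ≤ count (λ x → (Hb x ∧ not (W x)) ∧ q x)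
        before-j = subst₂ _≤_ (sym (as-final-segment Ia)) (sym (as-final-segment Hb))
          (≤-trans (count-mono (λ x → Ia x ∧ not (p x)) (λ x → Ij x ∧ not (p x)) Ia⇒Ij)
                   (deficit⇒surplus Ij Hb p (trans (size-I j) (sym (∈M⇒size H H∈M))) (I≼H j (N ∸ J + v))))
          where
          p = prefix j (N ∸ J + v)
          as-final-segment : ∀ f → count (λ x → (f x ∧ not (W x)) ∧ q x) ≡ count (λ x → f x ∧ not (p x))
          as-final-segment f = count-cong _ _ λ x →
            trans (∧-assoc (f x) (not (W x)) (q x)) (cong (f x ∧_) (¬prefix-∧-prefix-rank a j v v≤J x))
          Ia⇒Ij : ∀ x → Ia x ∧ not (p x) ≡ true → Ij x ∧ not (p x) ≡ true
          Ia⇒Ij x x∈ =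
            ∧-true⁺ (after-m⇒∈Ij x (∧-true⁻ˡ x∈) (<-≤-trans μ<v (¬prefix⁻ a v x (not-true⁻ ¬Wx)))) (∧-true⁻ʳ x∈)
            where
            ¬Wx : not (W x) ≡ true
            ¬Wx = ∧-true⁻ˡ (trans (¬prefix-∧-prefix-rank a j v v≤J x) (∧-true⁻ʳ x∈))

        from-j : count (λ x → (Ia x ∧ not (W x)) ∧ not (q x)) + 1 ≤ count (λ x → (Hb x ∧ not (W x)) ∧ not (q x))
        from-j = begin
          count (λ x → (Ia x ∧ not (W x)) ∧ not (q x)) + 1   ≡⟨ cong (_+ 1) (split Ia) ⟩
          𝟙 (Ia j) + #Ia + 1                                 ≡⟨ cong (λ b → 𝟙 b + #Ia + 1) j∉Ia′ ⟩
          #Ia + 1                                            ≡⟨ +-comm #Ia 1 ⟩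
          suc #Ia                                            ≤⟨ s≤s (deficit⇒surplus Ia Hb (prefix a (suc J)) |Ia|≡|H| (I≼H a (suc J))) ⟩
          suc #H                                             ≡⟨ cong (λ b → 𝟙 b + #H) ([]=⇒lookup j∈H) ⟨
          𝟙 (Hb j) + #H                                      ≡⟨ split Hb ⟨
          count (λ x → (Hb x ∧ not (W x)) ∧ not (q x))       ∎
          where
          open ≤-Reasoning
          #Ia #H : ℕ
          #Ia = count (λ x → Ia x ∧ not (prefix a (suc J) x))
          #H  = count (λ x → Hb x ∧ not (prefix a (suc J) x))
          ¬q⇒¬W : ∀ x → q x ≡ false → W x ≡ false
          ¬q⇒¬W x ¬qx = dec-false (rank a x <? v) λ x<v → <⇒≱ (<-≤-trans x<v v≤J) (¬prefix⁻ a J x ¬qx)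
          drop-¬W : ∀ f x → (f x ∧ not (W x)) ∧ not (q x) ≡ f x ∧ not (q x)
          drop-¬W f x with q x in qx
          ... | true  = trans (∧-zeroʳ _) (sym (∧-zeroʳ (f x)))
          ... | false rewrite ¬q⇒¬W x qx = cong (_∧ true) (∧-identityʳ (f x))
          split : ∀ f → count (λ x → (f x ∧ not (W x)) ∧ not (q x)) ≡ 𝟙 (f j) + count (λ x → f x ∧ not (prefix a (suc J) x))
          split f = trans (count-cong _ _ (drop-¬W f)) (count-¬prefix-rank a f j)

        X≼H-between : count (λ x → Hb x ∧ W x) ≤ count (λ x → Xb x ∧ W x)
        X≼H-between = s≤s⁻¹ (begin
          suc (count (λ x → Hb x ∧ W x))         ≡⟨ +-comm 1 _ ⟩
          count (λ x → Hb x ∧ W x) + 1           ≤⟨ surplus⇒deficit Ia Hb W 1 |Ia|≡|H| surplus ⟩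
          count IaW                              ≡⟨ count-remove IaW m (∧-true⁺ m∈Ia (prefix⁺ a m μ<v)) ⟩
          suc (count (remove m IaW))             ≤⟨ s≤s (count-mono (remove m IaW) (λ x → Xb x ∧ W x) removed⇒X) ⟩
          suc (count (λ x → Xb x ∧ W x))         ∎)
          where
          open ≤-Reasoning
          IaW : Fin N → Bool
          IaW x = Ia x ∧ W x
          removed⇒X : ∀ x → remove m IaW x ≡ true → Xb x ∧ W x ≡ true
          removed⇒X x x∈ = let x≢m , x∈IaW = remove-true IaW m x x∈ in
            ∧-true⁺ (Ia⇒X x (∧-true⁻ˡ x∈IaW) x≢m) (∧-true⁻ʳ x∈IaW)
          surplus : count (λ x → Ia x ∧ not (W x)) + 1 ≤ count (λ x → Hb x ∧ not (W x))
          surplus = begin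
            count (λ x → Ia x ∧ not (W x)) + 1   ≡⟨ cong (_+ 1) (count-split (λ x → Ia x ∧ not (W x)) q) ⟩
            Ia-before + Ia-from + 1              ≡⟨ +-assoc Ia-before Ia-from 1 ⟩
            Ia-before + (Ia-from + 1)            ≤⟨ +-mono-≤ before-j from-j ⟩
            H-before + H-from                    ≡⟨ count-split (λ x → Hb x ∧ not (W x)) q ⟨
            count (λ x → Hb x ∧ not (W x))       ∎
            where
            Ia-before = count (λ x → (Ia x ∧ not (W x)) ∧ q x)
            Ia-from   = count (λ x → (Ia x ∧ not (W x)) ∧ not (q x))
            H-before  = count (λ x → (Hb x ∧ not (W x)) ∧ q x)
            H-from    = count (λ x → (Hb x ∧ not (W x)) ∧ not (q x))

      X≼H : X ≼[ a ] H
      X≼H v with μ <? v | J <? v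
      ... | no μ≮v  | _       = X≼H-m-late v (≮⇒≥ μ≮v)
      ... | yes μ<v | yes J<v = X≼H-m-j-early v μ<v J<v
      ... | yes μ<v | no J≮v  = X≼H-between v μ<v (≮⇒≥ J≮v)

    K≡X : K a ≡ X
    K≡X = ≼-antisym a (K a) X
      (∈M′⇒≼ X (∈M X size-X I≼X) (lookup⇒[]= j X j∈X) a)
      (X≼H (K a) (proj₁ (K∈M′ a)) (proj₂ (K∈M′ a)))

  K≡exchange : ∀ a → j ∉ I a → Σ (Fin N) λ m → maxₜ a (I a ─ I j) ≡ just m × K a ≡ (I a - m) ∪ ⁅ j ⁆
  K≡exchange a j∉Ia with nonempty? (I a ─ I j)
  ... | yes (_ , y∈Ia─Ij) = let m , max≡m , m∈Ia─Ij , m-max = maxₜ-spec a (I a ─ I j) y∈Ia─Ij in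
    m , max≡m , Exchange.K≡X a j∉Ia m m∈Ia─Ij m-max
  ... | no Ia─Ij-empty = ⊥-elim (<-irrefl (trans (proj₁ (proj₁ isPositroid) a) (sym (proj₁ (proj₁ isPositroid) j)))
                                          (p⊂q⇒∣p∣<∣q∣ (Ia⊆Ij , j , j∈Ij , j∉Ia)))
    where
    Ia⊆Ij : I a ⊆ I j
    Ia⊆Ij {x} x∈Ia with x ∈? I j
    ... | yes x∈Ij = x∈Ij
    ... | no x∉Ij  = ⊥-elim (Ia─Ij-empty (x , x∈p∧x∉q⇒x∈p─q x∈Ia x∉Ij))

mainTheorem3 : (n k : ℕ) (M : Subset n → Set) (I : Fin n → Subset n)
    (π : Fin n → Fin n) (j : Fin n) (K : Fin n → Subset n) →
    IsPositroidWithNecklace n k M I →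
    IsNecklacePerm I π →
    π j ≢ j →
    IsPositroidWithNecklace n k (λ H → M H × j ∈ H) K →
    (a : Fin n) →
      (j ∈ I a → K a ≡ I a) ×
      (j ∉ I a → Σ (Fin n) (λ m →
         maxₜ a (I a ─ I j) ≡ just m × K a ≡ (I a - m) ∪ ⁅ j ⁆))
mainTheorem3 zero    k M I π () K isPositroid perm πj≢j isRestriction a
mainTheorem3 (suc n) k M I π j K isPositroid perm πj≢j isRestriction a =
  K≡I a , K≡exchange a
  where
  -- The only use of π j ≢ j: the necklace exchanges j at step j.
  j∈Ij : j ∈ I j
  j∈Ij = proj₁ (proj₁ (perm j) πj≢j)
  open Restriction k M I K j isPositroid j∈Ij isRestriction
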